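{- Let $n\ge2$, $w\in\mathcal S_n$ and $a,b\in\mathrm{R}(w)$. Then $a$ and $b$ are in the same commutation class if and only if $\Gamma(a,(x,y,z))=\Gamma(b,(x,y,z))$ for every triple $(x,y,z)\in\mathrm{T}_w$.
   Context: Applying a letter $i\in\{1,\dots,n-1\}$ to a word of length $n$ swaps its entries in positions $i$ and $i+1$. The length $\ell(w)$ is the number of inversions of $w$ (pairs of values $p>q$ with $p$ appearing before $q$ in $w$). A reduced word of $w$ is a word $a=a_1\cdots a_{\ell(w)}$ over $\{1,\dots,n-1\}$ such that applying successively $a_1,\dots,a_{\ell(w)}$ to the identity word $12\cdots n$ yields $w$; $\mathrm{R}(w)$ is the set of reduced words. In this process each letter $a_j$ swaps two adjacent values $q<p$, each inversion pair $(p,q)$ of $w$ being swapped by exactly one letter; the canonical labelling is $P_a(p,q)=j$ iff $a_j$ swaps $p$ and $q$. Two reduced words differ by a commutation if one is obtained from the other by replacing a factor $ij$ with $|i-j|\ge2$ by $ji$; the commutation class of $a$ is its class under sequences of commutations. $\mathrm{T}_w$ is the set of triples $(x,y,z)$ with $x<y<z$ such that $z$ appears before $y$ and $y$ before $x$ in $w$. $\Gamma(a,(x,y,z))=1$ if $P_a(y,x)>P_a(z,y)$ and $0$ if $P_a(y,x)<P_a(z,y)$. -}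

module Defs where

open import Data.Nat using (ℕ; zero; suc; _≤_; _<_; _<ᵇ_; _≡ᵇ_; _+_)
open import Data.Bool using (Bool; true; false; if_then_else_; _∧_; _∨_)
open import Data.List using (List; []; _∷_; _++_; length; upTo; map; foldl)
open import Data.List.Relation.Unary.All using (All)
open import Data.List.Membership.Propositional using (_∈_)
open import Data.List.Relation.Binary.Permutation.Propositional using (_↭_)
open import Data.Product using (_×_; ∃; ∃-syntax)
open import Relation.Binary.PropositionalEquality using (_≡_)
open import Relation.Binary.Construct.Closure.ReflexiveTransitive using (Star)

identityWord : ℕ → List ℕ
identityWord n = map suc (upTo n)

IsPerm : ℕ → List ℕ → Set
IsPerm n w = w ↭ identityWord n

-- Applying letter i (1-indexed) swaps the entries in positions i and i+1.
swapAt : ℕ → List ℕ → List ℕ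
swapAt (suc zero) (x ∷ y ∷ xs) = y ∷ x ∷ xs
swapAt (suc (suc k)) (x ∷ xs) = x ∷ swapAt (suc k) xs
swapAt _ xs = xs

applyWord : List ℕ → List ℕ → List ℕ
applyWord v a = foldl (λ u i → swapAt i u) v a

countLess : ℕ → List ℕ → ℕ
countLess x [] = 0
countLess x (y ∷ ys) = (if y <ᵇ x then 1 else 0) + countLess x ys

inversions : List ℕ → ℕ
inversions [] = 0
inversions (x ∷ xs) = countLess x xs + inversions xs

Reduced : ℕ → List ℕ → List ℕ → Set
Reduced n w a =
  All (λ i → 1 ≤ i × i < n) a × applyWord (identityWord n) a ≡ w × length a ≡ inversions w

-- entry at (1-indexed) position i; 0 if out of range (never a value of a word).
entry : ℕ → List ℕ → ℕ
entry _ [] = 0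
entry (suc zero) (x ∷ xs) = x
entry (suc (suc k)) (x ∷ xs) = entry (suc k) xs
entry zero (x ∷ xs) = 0

-- Search for the step j (counting from j₀) whose letter swaps the values p and q.
-- Returns 0 if no letter swaps them.
labelFrom : ℕ → List ℕ → List ℕ → ℕ → ℕ → ℕ
labelFrom j u [] p q = 0
labelFrom j u (i ∷ a) p q =
  let e₁ = entry i u ; e₂ = entry (suc i) u in
  if ((e₁ ≡ᵇ p) ∧ (e₂ ≡ᵇ q)) ∨ ((e₁ ≡ᵇ q) ∧ (e₂ ≡ᵇ p))
  then j
  else labelFrom (suc j) (swapAt i u) a p q

P : ℕ → List ℕ → ℕ → ℕ → ℕ
P n a p q = labelFrom 1 (identityWord n) a p q

Γ : ℕ → List ℕ → ℕ → ℕ → ℕ → ℕ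
Γ n a x y z = if P n a z y <ᵇ P n a y x then 1 else 0

Before : ℕ → ℕ → List ℕ → Set
Before p q w = ∃[ u ] ∃[ v ] (w ≡ u ++ (p ∷ v) × q ∈ v)

InT : List ℕ → ℕ → ℕ → ℕ → Set
InT w x y z = x < y × y < z × Before z y w × Before y x w

data FarApart : ℕ → ℕ → Set where
  left  : ∀ {i j} → i + 2 ≤ j → FarApart i j
  right : ∀ {i j} → j + 2 ≤ i → FarApart i j

data Commutation : List ℕ → List ℕ → Set where
  comm : ∀ u v i j → FarApart i j →
         Commutation (u ++ i ∷ j ∷ v) (u ++ j ∷ i ∷ v)

-- Same commutation class: connected by a sequence of commutations
-- (the one-step relation is symmetric, so its reflexive-transitive closure is the class relation).
SameCommClass : List ℕ → List ℕ → Set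
SameCommClass = Star Commutation

{-# OPTIONS --safe #-}
-- A reduced word a of w labels each of its steps by the pair of values it swaps, and Γ(a,(x,y,z))
-- records which of the pairs {y,z} and {x,y} is swapped first. A commutation exchanges two steps that
-- swap disjoint pairs, so it never changes this order: Γ is constant on commutation classes.
-- Conversely let a = i a′, and let e₁ < e₂ be the values in positions i and i+1 of the identity. As
-- a swaps them first, agreement of Γ on the triples (e₁,e₂,p) and (q,e₁,e₂) forces b to swap e₁ and
-- e₂ before moving either of them. Hence the letters of b preceding its first letter i are far from
-- i, b is commutation equivalent to i b′, and induction applies to a′ and b′ from s_i(12⋯n).
module Submission where

open import Defs
open import Data.Nat using (ℕ; zero; suc; _≤_; _<_; _+_; _<ᵇ_; _≡ᵇ_; z≤n; s≤s)
open import Data.Nat.Properties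
open import Data.Bool using (Bool; true; false; if_then_else_; _∧_; _∨_; not)
open import Data.Bool.Properties using (T-≡; T-∧; T-∨; ¬-not; ∨-zeroʳ; ∨-comm; ∨-commutativeMonoid)
open import Data.List using (List; []; _∷_; _++_; length; upTo)
open import Data.Bool.ListAction using (any)
open import Data.List.Properties using (length-++; length-map; length-upTo; foldl-++)
open import Data.List.Relation.Unary.All as All using (All; []; _∷_)
open import Data.List.Relation.Unary.All.Properties using (++⁺; ++⁻ˡ; ++⁻ʳ)
open import Data.List.Relation.Unary.Any using (here; there)
open import Data.List.Relation.Unary.AllPairs using (AllPairs; []; _∷_) renaming (map to AllPairs-map)
import Data.List.Relation.Unary.AllPairs.Properties as AllPairs
open import Data.List.Relation.Unary.Unique.Propositional using (Unique)
open import Data.List.Relation.Unary.Unique.Propositional.Properties using (Unique[x∷xs]⇒x∉xs)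
open import Data.List.Membership.Propositional using (_∈_)
open import Data.List.Relation.Binary.Permutation.Propositional
  using (_↭_; ↭-refl; ↭-prep; ↭-swap; ↭-trans; ↭-sym; ↭⇒↭ₛ)
open import Data.List.Relation.Binary.Permutation.Propositional.Properties using (∈-resp-↭; ↭-length)
open import Data.Product using (_×_; _,_; proj₁; proj₂; Σ; ∃₂)
open import Data.Sum using (_⊎_; inj₁; inj₂; [_,_]′)
open import Data.Empty using (⊥; ⊥-elim)
open import Function.Base using (_∘_; id)
open import Function.Bundles using (_⇔_; mk⇔; Equivalence)
open import Relation.Nullary using (¬_; contradiction)
open import Relation.Binary.Definitions using (tri<; tri≈; tri>)
open import Relation.Binary.PropositionalEquality
  using (_≡_; _≢_; ≢-sym; refl; sym; trans; cong; cong₂; subst; setoid; module ≡-Reasoning)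
open import Data.List.Relation.Binary.Permutation.Setoid.Properties (setoid ℕ) using (Unique-resp-↭)
open import Relation.Binary.Construct.Closure.ReflexiveTransitive using (ε; _◅_; _◅◅_; gmap; reverse)
open import Algebra.Bundles using (CommutativeMonoid)
import Algebra.Properties.CommutativeSemigroup as CommutativeSemigroupProperties
open CommutativeSemigroupProperties +-commutativeSemigroup using () renaming (x∙yz≈y∙xz to +-leftComm)
open CommutativeSemigroupProperties (CommutativeMonoid.commutativeSemigroup ∨-commutativeMonoid)
  using () renaming (x∙yz≈y∙xz to ∨-leftComm)

InRange : ℕ → ℕ → Set
InRange N c = 1 ≤ c × c < N

Letters : ℕ → List ℕ → Set
Letters N = All (InRange N)

-- Words with distinct entries

data Precedes (p q : ℕ) : List ℕ → Set where
  now   : ∀ {xs} → q ∈ xs → Precedes p q (p ∷ xs)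
  later : ∀ {x xs} → Precedes p q xs → Precedes p q (x ∷ xs)

precedes⇒∈ : ∀ {p q} {xs : List ℕ} → Precedes p q xs → p ∈ xs × q ∈ xs
precedes⇒∈ (now q∈)  = here refl , there q∈
precedes⇒∈ (later b) = there (proj₁ (precedes⇒∈ b)) , there (proj₂ (precedes⇒∈ b))

precedes-asym : ∀ {p q} {xs : List ℕ} → Unique xs → Precedes p q xs → ¬ Precedes q p xs
precedes-asym uq       (now _)   (now q∈)   = Unique[x∷xs]⇒x∉xs uq q∈
precedes-asym uq       (now _)   (later b′) = Unique[x∷xs]⇒x∉xs uq (proj₂ (precedes⇒∈ b′))
precedes-asym uq       (later b) (now _)    = Unique[x∷xs]⇒x∉xs uq (proj₂ (precedes⇒∈ b))
precedes-asym (_ ∷ uq) (later b) (later b′) = precedes-asym uq b b′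

precedes⇒Before : ∀ {p q} {xs : List ℕ} → Precedes p q xs → Before p q xs
precedes⇒Before {xs = _ ∷ xs} (now q∈) = [] , xs , refl , q∈
precedes⇒Before {xs = x ∷ _} (later b) with precedes⇒Before b
... | u , v , refl , q∈ = x ∷ u , v , refl , q∈

swapAt-↭ : ∀ k xs → swapAt k xs ↭ xs
swapAt-↭ zero          xs           = ↭-refl
swapAt-↭ (suc zero)    []           = ↭-refl
swapAt-↭ (suc zero)    (x ∷ [])     = ↭-refl
swapAt-↭ (suc zero)    (x ∷ y ∷ xs) = ↭-swap y x ↭-refl
swapAt-↭ (suc (suc k)) []           = ↭-refl
swapAt-↭ (suc (suc k)) (x ∷ xs)     = ↭-prep x (swapAt-↭ (suc k) xs)

applyWord-↭ : ∀ s a → applyWord s a ↭ s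
applyWord-↭ s []      = ↭-refl
applyWord-↭ s (c ∷ a) = ↭-trans (applyWord-↭ (swapAt c s) a) (swapAt-↭ c s)

length-swapAt : ∀ k xs → length (swapAt k xs) ≡ length xs
length-swapAt k xs = ↭-length (swapAt-↭ k xs)

length-applyWord : ∀ s a → length (applyWord s a) ≡ length s
length-applyWord s a = ↭-length (applyWord-↭ s a)

Unique-swapAt : ∀ k xs → Unique xs → Unique (swapAt k xs)
Unique-swapAt k xs = Unique-resp-↭ (↭⇒↭ₛ (↭-sym (swapAt-↭ k xs)))

Unique-applyWord : ∀ s a → Unique s → Unique (applyWord s a)
Unique-applyWord s a = Unique-resp-↭ (↭⇒↭ₛ (↭-sym (applyWord-↭ s a)))

∈-swapAt⁺ : ∀ {v : ℕ} k xs → v ∈ xs → v ∈ swapAt k xs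
∈-swapAt⁺ k xs = ∈-resp-↭ (↭-sym (swapAt-↭ k xs))

∈-swapAt⁻ : ∀ {v : ℕ} k xs → v ∈ swapAt k xs → v ∈ xs
∈-swapAt⁻ k xs = ∈-resp-↭ (swapAt-↭ k xs)

entry∈ : ∀ k xs → 1 ≤ k → k ≤ length xs → entry k xs ∈ xs
entry∈ (suc zero)    (x ∷ xs) _ _       = here refl
entry∈ (suc (suc k)) (x ∷ xs) _ (s≤s h) = there (entry∈ (suc k) xs (s≤s z≤n) h)

entry-distinct : ∀ m m′ xs → Unique xs → 1 ≤ m → m < m′ → m′ ≤ length xs → entry m xs ≢ entry m′ xs
entry-distinct (suc zero) (suc (suc m′)) (x ∷ xs) uq _ _ (s≤s h) x≡ =
  Unique[x∷xs]⇒x∉xs uq (subst (_∈ xs) (sym x≡) (entry∈ (suc m′) xs (s≤s z≤n) h))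
entry-distinct (suc (suc m)) (suc (suc m′)) (x ∷ xs) (_ ∷ uq) _ (s≤s m<m′) (s≤s h) =
  entry-distinct (suc m) (suc m′) xs uq (s≤s z≤n) m<m′ h
entry-distinct (suc zero) (suc zero) _ _ _ (s≤s ()) _

entry-injective : ∀ {m m′} xs → Unique xs → 1 ≤ m → m ≤ length xs → 1 ≤ m′ → m′ ≤ length xs →
  entry m xs ≡ entry m′ xs → m ≡ m′
entry-injective {m} {m′} xs uq m≥1 m≤ m′≥1 m′≤ e with <-cmp m m′
... | tri< m<m′ _ _ = ⊥-elim (entry-distinct m m′ xs uq m≥1 m<m′ m′≤ e)
... | tri≈ _ m≡m′ _ = m≡m′
... | tri> _ _ m′<m = ⊥-elim (entry-distinct m′ m xs uq m′≥1 m′<m m≤ (sym e))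

Pair : Set
Pair = ℕ × ℕ

pairAt : ℕ → List ℕ → Pair
pairAt i u = entry i u , entry (suc i) u

_∈ₚ_ : ℕ → Pair → Set
v ∈ₚ (a , b) = v ≡ a ⊎ v ≡ b

Disjointₚ : Pair → Pair → Set
Disjointₚ A B = ∀ {v} → v ∈ₚ A → v ∈ₚ B → ⊥

pairAt-precedes : ∀ c xs → InRange (length xs) c → Precedes (entry c xs) (entry (suc c) xs) xs
pairAt-precedes (suc zero)    (x ∷ y ∷ xs) _ = now (here refl)
pairAt-precedes (suc zero)    (x ∷ [])     (_ , s≤s ())
pairAt-precedes (suc (suc k)) (x ∷ xs)     (_ , s≤s h) = later (pairAt-precedes (suc k) xs (s≤s z≤n , h))

swapAt-precedes : ∀ c xs → InRange (length xs) c → Precedes (entry (suc c) xs) (entry c xs) (swapAt c xs)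
swapAt-precedes (suc zero)    (x ∷ y ∷ xs) _ = now (here refl)
swapAt-precedes (suc zero)    (x ∷ [])     (_ , s≤s ())
swapAt-precedes (suc (suc k)) (x ∷ xs)     (_ , s≤s h) = later (swapAt-precedes (suc k) xs (s≤s z≤n , h))

pairAt-distinct : ∀ c xs → Unique xs → InRange (length xs) c → entry c xs ≢ entry (suc c) xs
pairAt-distinct c xs uq (c≥1 , c<) = entry-distinct c (suc c) xs uq c≥1 ≤-refl c<

_≐ᵇ_ : Pair → Pair → Bool
(a , b) ≐ᵇ (c , d) = ((a ≡ᵇ c) ∧ (b ≡ᵇ d)) ∨ ((a ≡ᵇ d) ∧ (b ≡ᵇ c))

≡ᵇ-refl : ∀ m → (m ≡ᵇ m) ≡ true
≡ᵇ-refl m = Equivalence.to T-≡ (≡⇒≡ᵇ m m refl)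

≐ᵇ-refl : ∀ a b → (a , b) ≐ᵇ (a , b) ≡ true
≐ᵇ-refl a b rewrite ≡ᵇ-refl a | ≡ᵇ-refl b = refl

≐ᵇ-flip : ∀ a b → (a , b) ≐ᵇ (b , a) ≡ true
≐ᵇ-flip a b rewrite ≡ᵇ-refl a | ≡ᵇ-refl b = ∨-zeroʳ ((a ≡ᵇ b) ∧ (b ≡ᵇ a))

≐ᵇ-flipʳ : ∀ A p q → A ≐ᵇ (p , q) ≡ A ≐ᵇ (q , p)
≐ᵇ-flipʳ (a , b) p q = ∨-comm ((a ≡ᵇ p) ∧ (b ≡ᵇ q)) ((a ≡ᵇ q) ∧ (b ≡ᵇ p))

≐ᵇ-true⇒ : ∀ a b c d → (a , b) ≐ᵇ (c , d) ≡ true → (a ≡ c × b ≡ d) ⊎ (a ≡ d × b ≡ c)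
≐ᵇ-true⇒ a b c d h with Equivalence.to T-∨ (Equivalence.from T-≡ h)
... | inj₁ t = let ac , bd = Equivalence.to T-∧ t in inj₁ (≡ᵇ⇒≡ a c ac , ≡ᵇ⇒≡ b d bd)
... | inj₂ t = let ad , bc = Equivalence.to T-∧ t in inj₂ (≡ᵇ⇒≡ a d ad , ≡ᵇ⇒≡ b c bc)

≐ᵇ-true⇒∈₁ : ∀ A p q → A ≐ᵇ (p , q) ≡ true → p ∈ₚ A
≐ᵇ-true⇒∈₁ (a , b) p q h with ≐ᵇ-true⇒ a b p q h
... | inj₁ (a≡p , _) = inj₁ (sym a≡p)
... | inj₂ (_ , b≡p) = inj₂ (sym b≡p)

≐ᵇ-true⇒∈₂ : ∀ A p q → A ≐ᵇ (p , q) ≡ true → q ∈ₚ A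
≐ᵇ-true⇒∈₂ A p q h = ≐ᵇ-true⇒∈₁ A q p (trans (≐ᵇ-flipʳ A q p) h)

≐ᵇ-false₁ : ∀ A p q → ¬ p ∈ₚ A → A ≐ᵇ (p , q) ≡ false
≐ᵇ-false₁ A p q p∉ = ¬-not (p∉ ∘ ≐ᵇ-true⇒∈₁ A p q)

≐ᵇ-false₂ : ∀ A p q → ¬ q ∈ₚ A → A ≐ᵇ (p , q) ≡ false
≐ᵇ-false₂ A p q q∉ = ¬-not (q∉ ∘ ≐ᵇ-true⇒∈₂ A p q)

precedes-swapAt⁺ : ∀ {p q} c xs → pairAt c xs ≐ᵇ (p , q) ≡ false → Precedes p q xs → Precedes p q (swapAt c xs)
precedes-swapAt⁺ zero          xs           h b = b
precedes-swapAt⁺ (suc zero)    []           h b = b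
precedes-swapAt⁺ (suc zero)    (x ∷ [])     h b = b
precedes-swapAt⁺ (suc zero)    (x ∷ y ∷ xs) h (now (here refl)) with () ← trans (sym h) (≐ᵇ-refl x y)
precedes-swapAt⁺ (suc zero)    (x ∷ y ∷ xs) h (now (there q∈))  = later (now q∈)
precedes-swapAt⁺ (suc zero)    (x ∷ y ∷ xs) h (later (now q∈))  = now (there q∈)
precedes-swapAt⁺ (suc zero)    (x ∷ y ∷ xs) h (later (later b)) = later (later b)
precedes-swapAt⁺ (suc (suc k)) []           h b = b
precedes-swapAt⁺ (suc (suc k)) (x ∷ xs)     h (now q∈)  = now (∈-swapAt⁺ (suc k) xs q∈)
precedes-swapAt⁺ (suc (suc k)) (x ∷ xs)     h (later b) = later (precedes-swapAt⁺ (suc k) xs h b)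

precedes-swapAt⁻ : ∀ {p q} c xs → pairAt c xs ≐ᵇ (p , q) ≡ false → Precedes p q (swapAt c xs) → Precedes p q xs
precedes-swapAt⁻ zero          xs           h b = b
precedes-swapAt⁻ (suc zero)    []           h b = b
precedes-swapAt⁻ (suc zero)    (x ∷ [])     h b = b
precedes-swapAt⁻ (suc zero)    (x ∷ y ∷ xs) h (now (here refl)) with () ← trans (sym h) (≐ᵇ-flip x y)
precedes-swapAt⁻ (suc zero)    (x ∷ y ∷ xs) h (now (there q∈))  = later (now q∈)
precedes-swapAt⁻ (suc zero)    (x ∷ y ∷ xs) h (later (now q∈))  = now (there q∈)
precedes-swapAt⁻ (suc zero)    (x ∷ y ∷ xs) h (later (later b)) = later (later b)
precedes-swapAt⁻ (suc (suc k)) []           h b = b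
precedes-swapAt⁻ (suc (suc k)) (x ∷ xs)     h (now q∈)  = now (∈-swapAt⁻ (suc k) xs q∈)
precedes-swapAt⁻ (suc (suc k)) (x ∷ xs)     h (later b) = later (precedes-swapAt⁻ (suc k) xs h b)

-- Inversions and reduced runs

<ᵇ-true : ∀ {m n} → m < n → (m <ᵇ n) ≡ true
<ᵇ-true m<n = Equivalence.to T-≡ (<⇒<ᵇ m<n)

<ᵇ-false : ∀ {m n} → n ≤ m → (m <ᵇ n) ≡ false
<ᵇ-false {m} {n} n≤m = ¬-not (λ e → ≤⇒≯ n≤m (<ᵇ⇒< m n (Equivalence.from T-≡ e)))

countLess-swapAt : ∀ x k xs → countLess x (swapAt k xs) ≡ countLess x xs
countLess-swapAt x zero          xs           = refl
countLess-swapAt x (suc zero)    []           = refl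
countLess-swapAt x (suc zero)    (a ∷ [])     = refl
countLess-swapAt x (suc zero)    (a ∷ b ∷ xs) = +-leftComm (if b <ᵇ x then 1 else 0) (if a <ᵇ x then 1 else 0) (countLess x xs)
countLess-swapAt x (suc (suc k)) []           = refl
countLess-swapAt x (suc (suc k)) (a ∷ xs)     = cong (_ +_) (countLess-swapAt x (suc k) xs)

inversions-swapAt-ascent : ∀ c xs → InRange (length xs) c → entry c xs < entry (suc c) xs →
  inversions (swapAt c xs) ≡ suc (inversions xs)
inversions-swapAt-ascent (suc zero) (x ∷ y ∷ xs) _ x<y
  rewrite <ᵇ-true x<y | <ᵇ-false {y} {x} (<⇒≤ x<y) = cong suc (+-leftComm (countLess y xs) (countLess x xs) (inversions xs))
inversions-swapAt-ascent (suc zero) (x ∷ []) (_ , s≤s ()) _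
inversions-swapAt-ascent (suc (suc k)) (x ∷ xs) (_ , s≤s h) lt
  rewrite countLess-swapAt x (suc k) xs | inversions-swapAt-ascent (suc k) xs (s≤s z≤n , h) lt =
  +-suc (countLess x xs) (inversions xs)

inversions-swapAt-descent : ∀ c xs → InRange (length xs) c → entry (suc c) xs < entry c xs →
  suc (inversions (swapAt c xs)) ≡ inversions xs
inversions-swapAt-descent (suc zero) (x ∷ y ∷ xs) _ y<x
  rewrite <ᵇ-true y<x | <ᵇ-false {x} {y} (<⇒≤ y<x) = cong suc (+-leftComm (countLess y xs) (countLess x xs) (inversions xs))
inversions-swapAt-descent (suc zero) (x ∷ []) (_ , s≤s ()) _
inversions-swapAt-descent (suc (suc k)) (x ∷ xs) (_ , s≤s h) gt
  rewrite countLess-swapAt x (suc k) xs | sym (inversions-swapAt-descent (suc k) xs (s≤s z≤n , h) gt) =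
  sym (+-suc (countLess x xs) (inversions (swapAt (suc k) xs)))

AscentAt : List ℕ → ℕ → Set
AscentAt s c = InRange (length s) c × entry c s < entry (suc c) s

data ReducedFrom : List ℕ → List ℕ → Set where
  []  : ∀ {s} → ReducedFrom s []
  _∷_ : ∀ {s c a} → AscentAt s c → ReducedFrom (swapAt c s) a → ReducedFrom s (c ∷ a)

Letters-swapAt : ∀ c s {a} → Letters (length s) a → Letters (length (swapAt c s)) a
Letters-swapAt c s {a} = subst (λ N → Letters N a) (sym (length-swapAt c s))

ReducedFrom⇒Letters : ∀ {s a} → ReducedFrom s a → Letters (length s) a
ReducedFrom⇒Letters []                      = []
ReducedFrom⇒Letters {s} {c ∷ _} ((r , _) ∷ ra) =
  r ∷ subst (λ N → Letters N _) (length-swapAt c s) (ReducedFrom⇒Letters ra)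

inversions-applyWord : ∀ {s a} → ReducedFrom s a → inversions (applyWord s a) ≡ length a + inversions s
inversions-applyWord []                              = refl
inversions-applyWord {s} {c ∷ a} ((r , asc) ∷ ra) = begin
  inversions (applyWord (swapAt c s) a)  ≡⟨ inversions-applyWord ra ⟩
  length a + inversions (swapAt c s)     ≡⟨ cong (length a +_) (inversions-swapAt-ascent c s r asc) ⟩
  length a + suc (inversions s)          ≡⟨ +-suc (length a) (inversions s) ⟩
  suc (length a + inversions s)          ∎
  where open ≡-Reasoning

inversions-applyWord-≤ : ∀ s a → Unique s → Letters (length s) a →
  inversions (applyWord s a) ≤ length a + inversions s
inversions-applyWord-≤ s []      uq _        = ≤-refl
inversions-applyWord-≤ s (c ∷ a) uq (r ∷ ra) with <-cmp (entry c s) (entry (suc c) s)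
... | tri< asc _ _ = begin
  inversions (applyWord s′ a)      ≤⟨ IH ⟩
  length a + inversions s′         ≡⟨ cong (length a +_) (inversions-swapAt-ascent c s r asc) ⟩
  length a + suc (inversions s)    ≡⟨ +-suc (length a) (inversions s) ⟩
  suc (length a + inversions s)    ∎
  where
  open ≤-Reasoning
  s′ = swapAt c s
  IH = inversions-applyWord-≤ s′ a (Unique-swapAt c s uq) (Letters-swapAt c s ra)
... | tri≈ _ e _ = ⊥-elim (pairAt-distinct c s uq r e)
... | tri> _ _ desc = begin
  inversions (applyWord s′ a)      ≤⟨ IH ⟩
  length a + inversions s′         ≤⟨ n≤1+n _ ⟩
  suc (length a + inversions s′)   ≡⟨ sym (+-suc (length a) (inversions s′)) ⟩
  length a + suc (inversions s′)   ≡⟨ cong (length a +_) (inversions-swapAt-descent c s r desc) ⟩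
  length a + inversions s          ≤⟨ n≤1+n _ ⟩
  suc (length a + inversions s)    ∎
  where
  open ≤-Reasoning
  s′ = swapAt c s
  IH = inversions-applyWord-≤ s′ a (Unique-swapAt c s uq) (Letters-swapAt c s ra)

ReducedFrom-from-inversions : ∀ s a → Unique s → Letters (length s) a →
  inversions (applyWord s a) ≡ length a + inversions s → ReducedFrom s a
ReducedFrom-from-inversions s []      uq _        _  = []
ReducedFrom-from-inversions s (c ∷ a) uq (r ∷ ra) eq with <-cmp (entry c s) (entry (suc c) s)
... | tri< asc _ _ = (r , asc) ∷ ReducedFrom-from-inversions s′ a (Unique-swapAt c s uq) (Letters-swapAt c s ra) (begin
  inversions (applyWord s′ a)      ≡⟨ eq ⟩
  suc (length a + inversions s)    ≡⟨ sym (+-suc (length a) (inversions s)) ⟩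
  length a + suc (inversions s)    ≡⟨ cong (length a +_) (inversions-swapAt-ascent c s r asc) ⟨
  length a + inversions s′         ∎)
  where
  open ≡-Reasoning
  s′ = swapAt c s
... | tri≈ _ e _ = ⊥-elim (pairAt-distinct c s uq r e)
... | tri> _ _ desc = ⊥-elim (<-irrefl eq (begin-strict
  inversions (applyWord s′ a)      ≤⟨ inversions-applyWord-≤ s′ a (Unique-swapAt c s uq) (Letters-swapAt c s ra) ⟩
  length a + inversions s′         <⟨ +-monoʳ-< (length a) (≤-reflexive (inversions-swapAt-descent c s r desc)) ⟩
  length a + inversions s          <⟨ n<1+n _ ⟩
  suc (length a + inversions s)    ∎))
  where
  open ≤-Reasoning
  s′ = swapAt c s

-- The order in which pairs of values are swapped

swappedPairs : List ℕ → List ℕ → List Pair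
swappedPairs u []      = []
swappedPairs u (i ∷ a) = pairAt i u ∷ swappedPairs (swapAt i u) a

occurs : List Pair → Pair → Bool
occurs l π = any (_≐ᵇ π) l

labelLessCons : Bool → Bool → Bool → Bool → Bool → Bool
labelLessCons true  true  _  _   _    = false
labelLessCons true  false _  π′∈ _    = π′∈
labelLessCons false true  π∈ _   _    = not π∈
labelLessCons false false _  _   rest = rest

-- Whether the first occurrence of π in l comes before that of π′, an absent pair counting as
-- position 0: this is the comparison of the labels computed by labelFrom.
labelLess : List Pair → Pair → Pair → Bool
labelLess []      π π′ = false
labelLess (A ∷ l) π π′ = labelLessCons (A ≐ᵇ π) (A ≐ᵇ π′) (occurs l π) (occurs l π′) (labelLess l π π′)

labelFrom-∷ : ∀ j u i a p q → labelFrom j u (i ∷ a) p q ≡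
  (if pairAt i u ≐ᵇ (p , q) then j else labelFrom (suc j) (swapAt i u) a p q)
labelFrom-∷ j u i a p q = refl

labelFrom-absent : ∀ j u a p q → occurs (swappedPairs u a) (p , q) ≡ false → labelFrom j u a p q ≡ 0
labelFrom-absent j u []      p q _ = refl
labelFrom-absent j u (i ∷ a) p q h rewrite labelFrom-∷ j u i a p q with pairAt i u ≐ᵇ (p , q)
... | false = labelFrom-absent (suc j) (swapAt i u) a p q h

labelFrom-present : ∀ j u a p q → occurs (swappedPairs u a) (p , q) ≡ true → j ≤ labelFrom j u a p q
labelFrom-present j u (i ∷ a) p q h rewrite labelFrom-∷ j u i a p q with pairAt i u ≐ᵇ (p , q)
... | true  = ≤-refl
... | false = ≤-trans (n≤1+n j) (labelFrom-present (suc j) (swapAt i u) a p q h)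

labelFrom-<ᵇ : ∀ j u a p q p′ q′ →
  (labelFrom (suc j) u a p q <ᵇ labelFrom (suc j) u a p′ q′) ≡ labelLess (swappedPairs u a) (p , q) (p′ , q′)
labelFrom-<ᵇ j u []      p q p′ q′ = refl
labelFrom-<ᵇ j u (i ∷ a) p q p′ q′
  rewrite labelFrom-∷ (suc j) u i a p q | labelFrom-∷ (suc j) u i a p′ q′
  with pairAt i u ≐ᵇ (p , q) | pairAt i u ≐ᵇ (p′ , q′)
... | true  | true  = <ᵇ-false {suc j} ≤-refl
... | true  | false with occurs (swappedPairs (swapAt i u) a) (p′ , q′) in π′∈
...   | true  = <ᵇ-true (labelFrom-present (suc (suc j)) (swapAt i u) a p′ q′ π′∈)
...   | false rewrite labelFrom-absent (suc (suc j)) (swapAt i u) a p′ q′ π′∈ = refl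
labelFrom-<ᵇ j u (i ∷ a) p q p′ q′ | false | true with occurs (swappedPairs (swapAt i u) a) (p , q) in π∈
...   | true  = <ᵇ-false (≤-trans (n≤1+n (suc j)) (labelFrom-present (suc (suc j)) (swapAt i u) a p q π∈))
...   | false rewrite labelFrom-absent (suc (suc j)) (swapAt i u) a p q π∈ = refl
labelFrom-<ᵇ j u (i ∷ a) p q p′ q′ | false | false = labelFrom-<ᵇ (suc j) (swapAt i u) a p q p′ q′

labelLess-skip : ∀ A l π π′ → A ≐ᵇ π ≡ false → A ≐ᵇ π′ ≡ false → labelLess (A ∷ l) π π′ ≡ labelLess l π π′
labelLess-skip A l π π′ e e′ rewrite e | e′ = refl

labelLess-headˡ : ∀ A l π π′ → A ≐ᵇ π ≡ true → A ≐ᵇ π′ ≡ false → occurs l π′ ≡ true → labelLess (A ∷ l) π π′ ≡ true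
labelLess-headˡ A l π π′ e e′ o rewrite e | e′ = o

labelLess-headʳ : ∀ A l π π′ → A ≐ᵇ π ≡ false → A ≐ᵇ π′ ≡ true → occurs l π ≡ true → labelLess (A ∷ l) π π′ ≡ false
labelLess-headʳ A l π π′ e e′ o rewrite e | e′ | o = refl

occurs-commute : ∀ ps A B qs π → occurs (ps ++ A ∷ B ∷ qs) π ≡ occurs (ps ++ B ∷ A ∷ qs) π
occurs-commute []       A B qs π = ∨-leftComm (A ≐ᵇ π) (B ≐ᵇ π) (occurs qs π)
occurs-commute (C ∷ ps) A B qs π = cong ((C ≐ᵇ π) ∨_) (occurs-commute ps A B qs π)

labelLessCons-commute : ∀ a₁ a₂ b₁ b₂ f₁ f₂ r → (a₁ ≡ true → b₂ ≡ true → ⊥) → (b₁ ≡ true → a₂ ≡ true → ⊥) →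
  labelLessCons a₁ a₂ (b₁ ∨ f₁) (b₂ ∨ f₂) (labelLessCons b₁ b₂ f₁ f₂ r) ≡
  labelLessCons b₁ b₂ (a₁ ∨ f₁) (a₂ ∨ f₂) (labelLessCons a₁ a₂ f₁ f₂ r)
labelLessCons-commute true  _     _     true  _ _ _ h _ = ⊥-elim (h refl refl)
labelLessCons-commute _     true  true  _     _ _ _ _ h = ⊥-elim (h refl refl)
labelLessCons-commute true  true  false false _ _ _ _ _ = refl
labelLessCons-commute true  false true  false _ _ _ _ _ = refl
labelLessCons-commute true  false false false _ _ _ _ _ = refl
labelLessCons-commute false true  false true  _ _ _ _ _ = refl
labelLessCons-commute false true  false false _ _ _ _ _ = refl
labelLessCons-commute false false _     _     _ _ _ _ _ = refl

-- (z , y) and (y , x) share y, so the disjoint pairs A and B cannot match one each.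
labelLess-commute : ∀ ps A B qs x y z → Disjointₚ A B →
  labelLess (ps ++ A ∷ B ∷ qs) (z , y) (y , x) ≡ labelLess (ps ++ B ∷ A ∷ qs) (z , y) (y , x)
labelLess-commute [] A B qs x y z A∩B =
  labelLessCons-commute (A ≐ᵇ π) (A ≐ᵇ π′) (B ≐ᵇ π) (B ≐ᵇ π′) (occurs qs π) (occurs qs π′) (labelLess qs π π′)
    (λ A≐π B≐π′ → A∩B (≐ᵇ-true⇒∈₂ A z y A≐π) (≐ᵇ-true⇒∈₁ B y x B≐π′))
    (λ B≐π A≐π′ → A∩B (≐ᵇ-true⇒∈₁ A y x A≐π′) (≐ᵇ-true⇒∈₂ B z y B≐π))
  where
  π = (z , y)
  π′ = (y , x)
labelLess-commute (C ∷ ps) A B qs x y z A∩B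
  rewrite occurs-commute ps A B qs (z , y) | occurs-commute ps A B qs (y , x)
        | labelLess-commute ps A B qs x y z A∩B = refl

inversion-persists : ∀ {s a p q} → ReducedFrom s a → Unique s → q < p → Precedes p q s →
  Precedes p q (applyWord s a)
inversion-persists [] _ _ b = b
inversion-persists {s} {c ∷ a} {p} {q} ((r , asc) ∷ ra) uq q<p b =
  inversion-persists ra (Unique-swapAt c s uq) q<p (precedes-swapAt⁺ c s (¬-not notSwapped) b)
  where
  notSwapped : pairAt c s ≐ᵇ (p , q) ≢ true
  notSwapped h with ≐ᵇ-true⇒ (entry c s) (entry (suc c) s) p q h
  ... | inj₁ (refl , refl) = <-asym asc q<p
  ... | inj₂ (refl , refl) = precedes-asym uq b (pairAt-precedes c s r)

occurs-if-reordered : ∀ {s a p q} → ReducedFrom s a → Unique s → Precedes q p s →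
  Precedes p q (applyWord s a) → occurs (swappedPairs s a) (p , q) ≡ true
occurs-if-reordered [] uq b b′ = ⊥-elim (precedes-asym uq b b′)
occurs-if-reordered {s} {c ∷ a} {p} {q} (_ ∷ ra) uq b b′ with pairAt c s ≐ᵇ (p , q) in e
... | true  = refl
... | false = occurs-if-reordered ra (Unique-swapAt c s uq)
                (precedes-swapAt⁺ c s (trans (≐ᵇ-flipʳ (pairAt c s) q p) e) b) b′

-- Commutations

farApart-sym : ∀ {i k} → FarApart i k → FarApart k i
farApart-sym (left h)  = right h
farApart-sym (right h) = left h

∈ₚ-succ-bounds : ∀ {m i} → m ∈ₚ (i , suc i) → i ≤ m × m ≤ suc i
∈ₚ-succ-bounds (inj₁ refl) = ≤-refl , n≤1+n _
∈ₚ-succ-bounds (inj₂ refl) = n≤1+n _ , ≤-refl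

farApart-positions≢ : ∀ {i k m m′} → FarApart i k → m ∈ₚ (i , suc i) → m′ ∈ₚ (k , suc k) → m ≢ m′
farApart-positions≢ {i} {k} (left h) m∈ m′∈ =
  <⇒≢ (≤-trans (s≤s (proj₂ (∈ₚ-succ-bounds m∈))) (≤-trans (≤-reflexive (+-comm 2 i)) (≤-trans h (proj₁ (∈ₚ-succ-bounds m′∈)))))
farApart-positions≢ {i} {k} (right h) m∈ m′∈ =
  ≢-sym (<⇒≢ (≤-trans (s≤s (proj₂ (∈ₚ-succ-bounds m′∈))) (≤-trans (≤-reflexive (+-comm 2 k)) (≤-trans h (proj₁ (∈ₚ-succ-bounds m∈))))))

entry-swapAt : ∀ m k s → m ≢ k → m ≢ suc k → entry m (swapAt k s) ≡ entry m s
entry-swapAt m                   zero          s            _  _  = refl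
entry-swapAt m                   (suc zero)    []           _  _  = refl
entry-swapAt m                   (suc zero)    (x ∷ [])     _  _  = refl
entry-swapAt zero                (suc zero)    (x ∷ y ∷ xs) _  _  = refl
entry-swapAt (suc zero)          (suc zero)    (x ∷ y ∷ xs) m≢ _  = ⊥-elim (m≢ refl)
entry-swapAt (suc (suc zero))    (suc zero)    (x ∷ y ∷ xs) _  m≢ = ⊥-elim (m≢ refl)
entry-swapAt (suc (suc (suc m))) (suc zero)    (x ∷ y ∷ xs) _  _  = refl
entry-swapAt m                   (suc (suc k)) []           _  _  = refl
entry-swapAt zero                (suc (suc k)) (x ∷ xs)     _  _  = refl
entry-swapAt (suc zero)          (suc (suc k)) (x ∷ xs)     _  _  = refl
entry-swapAt (suc (suc m))       (suc (suc k)) (x ∷ xs)     m≢ m≢′ =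
  entry-swapAt (suc m) (suc k) xs (m≢ ∘ cong suc) (m≢′ ∘ cong suc)

pairAt-swapAt-far : ∀ {k i} → FarApart k i → ∀ s → pairAt i (swapAt k s) ≡ pairAt i s
pairAt-swapAt-far {k} {i} far s = cong₂ _,_ (unmoved (inj₁ refl)) (unmoved (inj₂ refl))
  where
  unmoved : ∀ {m} → m ∈ₚ (i , suc i) → entry m (swapAt k s) ≡ entry m s
  unmoved m∈ = entry-swapAt _ k s (≢-sym (farApart-positions≢ far (inj₁ refl) m∈))
                                  (≢-sym (farApart-positions≢ far (inj₂ refl) m∈))

∈ₚ-pairAt : ∀ {s j v} → InRange (length s) j → v ∈ₚ pairAt j s →
  Σ ℕ λ m → m ∈ₚ (j , suc j) × 1 ≤ m × m ≤ length s × v ≡ entry m s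
∈ₚ-pairAt (j≥1 , j<) (inj₁ e) = _ , inj₁ refl , j≥1 , <⇒≤ j< , e
∈ₚ-pairAt (j≥1 , j<) (inj₂ e) = _ , inj₂ refl , s≤s z≤n , j< , e

pairAt-disjoint : ∀ s {i k} → Unique s → InRange (length s) i → InRange (length s) k → FarApart i k →
  Disjointₚ (pairAt i s) (pairAt k s)
pairAt-disjoint s uq ri rk far v∈A v∈B with ∈ₚ-pairAt {s} ri v∈A | ∈ₚ-pairAt {s} rk v∈B
... | m , m∈ , m≥1 , m≤ , refl | m′ , m′∈ , m′≥1 , m′≤ , e =
  farApart-positions≢ far m∈ m′∈ (entry-injective s uq m≥1 m≤ m′≥1 m′≤ e)

swapAt-comm-< : ∀ i k s → suc (suc i) ≤ k → swapAt i (swapAt k s) ≡ swapAt k (swapAt i s)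
swapAt-comm-< zero          k                         s            _       = refl
swapAt-comm-< (suc zero)    (suc zero)                s            (s≤s ())
swapAt-comm-< (suc zero)    (suc (suc zero))          s            (s≤s (s≤s ()))
swapAt-comm-< (suc (suc i)) (suc zero)                s            (s≤s ())
swapAt-comm-< (suc (suc i)) (suc (suc zero))          s            (s≤s (s≤s ()))
swapAt-comm-< (suc (suc i)) (suc (suc (suc zero)))    s            (s≤s (s≤s (s≤s ())))
swapAt-comm-< (suc zero)    (suc (suc (suc k)))       []           _       = refl
swapAt-comm-< (suc zero)    (suc (suc (suc k)))       (x ∷ [])     _       = refl
swapAt-comm-< (suc zero)    (suc (suc (suc k)))       (x ∷ y ∷ xs) _       = refl
swapAt-comm-< (suc (suc i)) (suc (suc (suc (suc k)))) []           _       = refl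
swapAt-comm-< (suc (suc i)) (suc (suc (suc (suc k)))) (x ∷ xs)     (s≤s h) =
  cong (x ∷_) (swapAt-comm-< (suc i) (suc (suc (suc k))) xs h)

swapAt-comm : ∀ {i k} → FarApart i k → ∀ s → swapAt i (swapAt k s) ≡ swapAt k (swapAt i s)
swapAt-comm {i} {k} (left h)  s = swapAt-comm-< i k s (subst (_≤ k) (+-comm i 2) h)
swapAt-comm {i} {k} (right h) s = sym (swapAt-comm-< k i s (subst (_≤ i) (+-comm k 2) h))

Commutation-sym : ∀ {a b} → Commutation a b → Commutation b a
Commutation-sym (comm u v i j far) = comm u v j i (farApart-sym far)

SameCommClass-sym : ∀ {a b} → SameCommClass a b → SameCommClass b a
SameCommClass-sym = reverse Commutation-sym

∷-SameCommClass : ∀ c {a b} → SameCommClass a b → SameCommClass (c ∷ a) (c ∷ b)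
∷-SameCommClass c = gmap (c ∷_) λ { (comm u v i j far) → comm (c ∷ u) v i j far }

commute-past : ∀ i cs d → All (FarApart i) cs → SameCommClass (i ∷ cs ++ d) (cs ++ i ∷ d)
commute-past i []       d []           = ε
commute-past i (c ∷ cs) d (far ∷ fars) = comm [] (cs ++ d) i c far ◅ ∷-SameCommClass c (commute-past i cs d fars)

SameCommClass⇒applyWord≡ : ∀ {a b} → SameCommClass a b → ∀ s → applyWord s a ≡ applyWord s b
SameCommClass⇒applyWord≡ ε s = refl
SameCommClass⇒applyWord≡ (comm u v i j far ◅ rest) s = trans (begin
  applyWord s (u ++ i ∷ j ∷ v)                 ≡⟨ foldl-++ _ s u (i ∷ j ∷ v) ⟩
  applyWord (swapAt j (swapAt i t)) v          ≡⟨ cong (λ t′ → applyWord t′ v) (swapAt-comm far t) ⟨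
  applyWord (swapAt i (swapAt j t)) v          ≡⟨ foldl-++ _ s u (j ∷ i ∷ v) ⟨
  applyWord s (u ++ j ∷ i ∷ v)                 ∎) (SameCommClass⇒applyWord≡ rest s)
  where
  open ≡-Reasoning
  t = applyWord s u

SameCommClass⇒length≡ : ∀ {a b} → SameCommClass a b → length a ≡ length b
SameCommClass⇒length≡ ε = refl
SameCommClass⇒length≡ (comm u v i j _ ◅ rest) = trans (trans (length-++ u) (sym (length-++ u))) (SameCommClass⇒length≡ rest)

SameCommClass⇒All : ∀ {P : ℕ → Set} {a b} → SameCommClass a b → All P a → All P b
SameCommClass⇒All ε pa = pa
SameCommClass⇒All (comm u v i j _ ◅ rest) pa with ++⁻ʳ u pa
... | pi ∷ pj ∷ pv = SameCommClass⇒All rest (++⁺ (++⁻ˡ u pa) (pj ∷ pi ∷ pv))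

ReducedFrom-resp-SameCommClass : ∀ {s a b} → Unique s → SameCommClass a b → ReducedFrom s a → ReducedFrom s b
ReducedFrom-resp-SameCommClass {s} {a} {b} uq a~b ra =
  ReducedFrom-from-inversions s b uq (SameCommClass⇒All a~b (ReducedFrom⇒Letters ra)) (begin
    inversions (applyWord s b)  ≡⟨ cong inversions (SameCommClass⇒applyWord≡ a~b s) ⟨
    inversions (applyWord s a)  ≡⟨ inversions-applyWord ra ⟩
    length a + inversions s     ≡⟨ cong (_+ inversions s) (SameCommClass⇒length≡ a~b) ⟩
    length b + inversions s     ∎)
  where open ≡-Reasoning

swappedPairs-++ : ∀ u c d → swappedPairs u (c ++ d) ≡ swappedPairs u c ++ swappedPairs (applyWord u c) d
swappedPairs-++ u []      d = refl
swappedPairs-++ u (i ∷ c) d = cong (pairAt i u ∷_) (swappedPairs-++ (swapAt i u) c d)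

swappedPairs-far : ∀ {i k} → FarApart i k → ∀ s v →
  swappedPairs s (i ∷ k ∷ v) ≡ pairAt i s ∷ pairAt k s ∷ swappedPairs (swapAt k (swapAt i s)) v
swappedPairs-far {i} {k} far s v =
  cong (λ B → pairAt i s ∷ B ∷ swappedPairs (swapAt k (swapAt i s)) v) (pairAt-swapAt-far far s)

labelLess-commutation : ∀ u {a b} → Unique u → Letters (length u) a → Commutation a b → ∀ x y z →
  labelLess (swappedPairs u a) (z , y) (y , x) ≡ labelLess (swappedPairs u b) (z , y) (y , x)
labelLess-commutation u uq ra (comm c v i k far) x y z = begin
  L (swappedPairs u (c ++ i ∷ k ∷ v))                       ≡⟨ cong L (swappedPairs-++ u c _) ⟩
  L (ps ++ swappedPairs s (i ∷ k ∷ v))                      ≡⟨ cong (λ l → L (ps ++ l)) (swappedPairs-far far s v) ⟩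
  L (ps ++ A ∷ B ∷ swappedPairs (swapAt k (swapAt i s)) v)  ≡⟨ labelLess-commute ps A B _ x y z A∩B ⟩
  L (ps ++ B ∷ A ∷ swappedPairs (swapAt k (swapAt i s)) v)  ≡⟨ cong (λ t → L (ps ++ B ∷ A ∷ swappedPairs t v)) (swapAt-comm far s) ⟨
  L (ps ++ B ∷ A ∷ swappedPairs (swapAt i (swapAt k s)) v)  ≡⟨ cong (λ l → L (ps ++ l)) (swappedPairs-far (farApart-sym far) s v) ⟨
  L (ps ++ swappedPairs s (k ∷ i ∷ v))                      ≡⟨ cong L (swappedPairs-++ u c _) ⟨
  L (swappedPairs u (c ++ k ∷ i ∷ v))                       ∎
  where
  open ≡-Reasoning
  L : List Pair → Bool
  L l = labelLess l (z , y) (y , x)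
  s = applyWord u c
  ps = swappedPairs u c
  A = pairAt i s
  B = pairAt k s
  rs : Letters (length s) (i ∷ k ∷ v)
  rs = subst (λ N → Letters N _) (sym (length-applyWord u c)) (++⁻ʳ c ra)
  A∩B : Disjointₚ A B
  A∩B = pairAt-disjoint s (Unique-applyWord u c uq) (All.head rs) (All.head (All.tail rs)) far

labelLess-resp-SameCommClass : ∀ u {a b} → Unique u → Letters (length u) a → SameCommClass a b → ∀ x y z →
  labelLess (swappedPairs u a) (z , y) (y , x) ≡ labelLess (swappedPairs u b) (z , y) (y , x)
labelLess-resp-SameCommClass u uq ra ε x y z = refl
labelLess-resp-SameCommClass u uq ra (step ◅ steps) x y z =
  trans (labelLess-commutation u uq ra step x y z)
        (labelLess-resp-SameCommClass u uq (SameCommClass⇒All (step ◅ ε) ra) steps x y z)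

-- Equal Γ forces the same commutation class

ReducedFrom-length≡ : ∀ {s a b} → ReducedFrom s a → ReducedFrom s b → applyWord s a ≡ applyWord s b →
  length a ≡ length b
ReducedFrom-length≡ {s} {a} {b} ra rb eq = +-cancelʳ-≡ (inversions s) (length a) (length b) (begin
  length a + inversions s     ≡⟨ inversions-applyWord ra ⟨
  inversions (applyWord s a)  ≡⟨ cong inversions eq ⟩
  inversions (applyWord s b)  ≡⟨ inversions-applyWord rb ⟩
  length b + inversions s     ∎)
  where open ≡-Reasoning

-- The hypothesis of the theorem for runs from u: Γ(a,(x,y,z)) = Γ(b,(x,y,z)) for every triple
-- that is increasing in u and reversed by a.
LabelsAgree : List ℕ → List ℕ → List ℕ → Set
LabelsAgree u a b = ∀ x y z → x < y → y < z → Precedes x y u → Precedes y z u →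
  Precedes z y (applyWord u a) → Precedes y x (applyWord u a) →
  labelLess (swappedPairs u a) (z , y) (y , x) ≡ labelLess (swappedPairs u b) (z , y) (y , x)

LabelsAgree-resp-SameCommClass : ∀ {u a b b′} → Unique u → Letters (length u) b → SameCommClass b b′ →
  LabelsAgree u a b → LabelsAgree u a b′
LabelsAgree-resp-SameCommClass {u} uq rb b~b′ agree x y z x<y y<z x≺y y≺z z≺y y≺x =
  trans (agree x y z x<y y<z x≺y y≺z z≺y y≺x) (labelLess-resp-SameCommClass u uq rb b~b′ x y z)

-- The first swapped pair is an ascent of u, so it is neither of the two inversions of a triple.
LabelsAgree-tail : ∀ {u i a b} → Unique u → AscentAt u i → LabelsAgree u (i ∷ a) (i ∷ b) →
  LabelsAgree (swapAt i u) a b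
LabelsAgree-tail {u} {i} {a} {b} uq (r , asc) agree x y z x<y y<z x≺y y≺z z≺y y≺x = begin
  labelLess (swappedPairs u′ a) (z , y) (y , x)       ≡⟨ skip a ⟨
  labelLess (swappedPairs u (i ∷ a)) (z , y) (y , x)  ≡⟨ agree x y z x<y y<z (unswapped x<y x≺y) (unswapped y<z y≺z) z≺y y≺x ⟩
  labelLess (swappedPairs u (i ∷ b)) (z , y) (y , x)  ≡⟨ skip b ⟩
  labelLess (swappedPairs u′ b) (z , y) (y , x)       ∎
  where
  open ≡-Reasoning
  u′ = swapAt i u
  A = pairAt i u
  notA : ∀ {p q} → p < q → Precedes p q u′ → A ≐ᵇ (p , q) ≡ false
  notA {p} {q} p<q p≺q = ¬-not λ h → case (≐ᵇ-true⇒ (entry i u) (entry (suc i) u) p q h)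
    where
    case : (entry i u ≡ p × entry (suc i) u ≡ q) ⊎ (entry i u ≡ q × entry (suc i) u ≡ p) → ⊥
    case (inj₁ (refl , refl)) = precedes-asym (Unique-swapAt i u uq) p≺q (swapAt-precedes i u r)
    case (inj₂ (refl , refl)) = <-asym p<q asc
  unswapped : ∀ {p q} → p < q → Precedes p q u′ → Precedes p q u
  unswapped p<q p≺q = precedes-swapAt⁻ i u (notA p<q p≺q) p≺q
  skip : ∀ c → labelLess (swappedPairs u (i ∷ c)) (z , y) (y , x) ≡ labelLess (swappedPairs u′ c) (z , y) (y , x)
  skip c = labelLess-skip A (swappedPairs u′ c) (z , y) (y , x)
             (trans (≐ᵇ-flipʳ A z y) (notA y<z y≺z)) (trans (≐ᵇ-flipʳ A y x) (notA x<y x≺y))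

SwappedBeforeAbove : List ℕ → List ℕ → ℕ → ℕ → Set
SwappedBeforeAbove s a e₁ e₂ = ∀ p → e₂ < p → Precedes e₂ p s → Precedes p e₂ (applyWord s a) →
  labelLess (swappedPairs s a) (p , e₂) (e₂ , e₁) ≡ false

SwappedBeforeBelow : List ℕ → List ℕ → ℕ → ℕ → Set
SwappedBeforeBelow s a e₁ e₂ = ∀ q → q < e₁ → Precedes q e₁ s → Precedes e₁ q (applyWord s a) →
  labelLess (swappedPairs s a) (e₂ , e₁) (e₁ , q) ≡ true

swappedAboveFirst-impossible : ∀ {s i rest} → Unique s → 1 ≤ i → entry i s < entry (suc i) s →
  ReducedFrom s (suc i ∷ rest) → Precedes (entry (suc i) s) (entry i s) (applyWord s (suc i ∷ rest)) →
  ¬ SwappedBeforeAbove s (suc i ∷ rest) (entry i s) (entry (suc i) s)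
swappedAboveFirst-impossible {s} {i} {rest} uq i≥1 e₁<e₂ ((r , e₂<p) ∷ ra) e₂≺e₁ before =
  contradiction (trans (sym (before p e₂<p (pairAt-precedes (suc i) s r) p≺e₂)) swappedAboveFirst) λ ()
  where
  e₁ = entry i s
  e₂ = entry (suc i) s
  p = entry (suc (suc i)) s
  s′ = swapAt (suc i) s
  e₁∉ : ¬ e₁ ∈ₚ (e₂ , p)
  e₁∉ = [ <⇒≢ e₁<e₂ , <⇒≢ (<-trans e₁<e₂ e₂<p) ]′
  p≺e₂ : Precedes p e₂ (applyWord s′ rest)
  p≺e₂ = inversion-persists ra (Unique-swapAt (suc i) s uq) e₂<p (swapAt-precedes (suc i) s r)
  e₁≺e₂ : Precedes e₁ e₂ s′
  e₁≺e₂ = precedes-swapAt⁺ (suc i) s (≐ᵇ-false₁ (e₂ , p) e₁ e₂ e₁∉)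
            (pairAt-precedes i s (i≥1 , <-trans (n<1+n i) (proj₂ r)))
  swappedAboveFirst : labelLess (swappedPairs s (suc i ∷ rest)) (p , e₂) (e₂ , e₁) ≡ true
  swappedAboveFirst = labelLess-headˡ (e₂ , p) (swappedPairs s′ rest) (p , e₂) (e₂ , e₁) (≐ᵇ-flip e₂ p) (≐ᵇ-false₂ (e₂ , p) e₂ e₁ e₁∉)
                        (occurs-if-reordered ra (Unique-swapAt (suc i) s uq) e₁≺e₂ e₂≺e₁)

swappedBelowFirst-impossible : ∀ {s c rest} → Unique s → suc c < length s →
  entry (suc c) s < entry (suc (suc c)) s → ReducedFrom s (c ∷ rest) →
  Precedes (entry (suc (suc c)) s) (entry (suc c) s) (applyWord s (c ∷ rest)) →
  ¬ SwappedBeforeBelow s (c ∷ rest) (entry (suc c) s) (entry (suc (suc c)) s)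
swappedBelowFirst-impossible {s} {c} {rest} uq sc< e₁<e₂ ((r , q<e₁) ∷ ra) e₂≺e₁ before =
  contradiction (trans (sym (before q q<e₁ (pairAt-precedes c s r) e₁≺q)) swappedBelowFirst) λ ()
  where
  q = entry c s
  e₁ = entry (suc c) s
  e₂ = entry (suc (suc c)) s
  s′ = swapAt c s
  e₂∉ : ¬ e₂ ∈ₚ (q , e₁)
  e₂∉ = [ ≢-sym (<⇒≢ (<-trans q<e₁ e₁<e₂)) , ≢-sym (<⇒≢ e₁<e₂) ]′
  e₁≺q : Precedes e₁ q (applyWord s′ rest)
  e₁≺q = inversion-persists ra (Unique-swapAt c s uq) q<e₁ (swapAt-precedes c s r)
  e₁≺e₂ : Precedes e₁ e₂ s′
  e₁≺e₂ = precedes-swapAt⁺ c s (≐ᵇ-false₂ (q , e₁) e₁ e₂ e₂∉) (pairAt-precedes (suc c) s (s≤s z≤n , sc<))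
  swappedBelowFirst : labelLess (swappedPairs s (c ∷ rest)) (e₂ , e₁) (e₁ , q) ≡ false
  swappedBelowFirst = labelLess-headʳ (q , e₁) (swappedPairs s′ rest) (e₂ , e₁) (e₁ , q)
                        (≐ᵇ-false₁ (q , e₁) e₂ e₁ e₂∉) (≐ᵇ-flip q e₁)
                        (occurs-if-reordered ra (Unique-swapAt c s uq) e₁≺e₂ e₂≺e₁)

data Neighbourhood : ℕ → ℕ → Set where
  same  : ∀ {i} → Neighbourhood i i
  above : ∀ {i} → Neighbourhood i (suc i)
  below : ∀ {c} → Neighbourhood (suc c) c
  apart : ∀ {i c} → FarApart i c → Neighbourhood i c

neighbourhood : ∀ i c → Neighbourhood i c
neighbourhood i c with <-cmp i c
... | tri≈ _ refl _ = same
... | tri< i<c _ _ with m≤n⇒m<n∨m≡n i<c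
...   | inj₂ refl  = above
...   | inj₁ 1+i<c = apart (left (subst (_≤ c) (+-comm 2 i) 1+i<c))
neighbourhood i c | tri> _ _ c<i with m≤n⇒m<n∨m≡n c<i
...   | inj₂ refl  = below
...   | inj₁ 1+c<i = apart (right (subst (_≤ i) (+-comm 2 c) 1+c<i))

-- If (e₁, e₂) = pairAt i s is swapped before every other pair containing e₁ or e₂, then the letters
-- of b before the first occurrence of i touch neither position i nor i + 1, so they commute with i.
commutingPrefix : ∀ {s i e₁ e₂} b → Unique s → ReducedFrom s b → InRange (length s) i →
  pairAt i s ≡ (e₁ , e₂) → e₁ < e₂ → Precedes e₂ e₁ (applyWord s b) →
  SwappedBeforeAbove s b e₁ e₂ → SwappedBeforeBelow s b e₁ e₂ →
  ∃₂ λ cs d → b ≡ cs ++ i ∷ d × All (FarApart i) cs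
commutingPrefix {s} {i} [] uq [] r refl _ e₂≺e₁ _ _ = ⊥-elim (precedes-asym uq (pairAt-precedes i s r) e₂≺e₁)
commutingPrefix {s} {i} {e₁} {e₂} (c ∷ b) uq rb r pair e₁<e₂ e₂≺e₁ swAbove swBelow with neighbourhood i c | pair
... | same  | _    = [] , b , refl , []
... | above | refl = ⊥-elim (swappedAboveFirst-impossible uq (proj₁ r) e₁<e₂ rb e₂≺e₁ swAbove)
... | below | refl = ⊥-elim (swappedBelowFirst-impossible uq (proj₂ r) e₁<e₂ rb e₂≺e₁ swBelow)
... | apart far | _ with rb
...   | (rc , _) ∷ rb′ = extend (commutingPrefix b (Unique-swapAt c s uq) rb′
                           (subst (λ N → InRange N i) (sym (length-swapAt c s)) r)
                           (trans (pairAt-swapAt-far (farApart-sym far) s) pair)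
                           e₁<e₂ e₂≺e₁ swAbove′ swBelow′)
  where
  C = pairAt c s
  C∩ : Disjointₚ C (e₁ , e₂)
  C∩ = subst (Disjointₚ C) pair (pairAt-disjoint s uq rc r (farApart-sym far))
  e₁∉C : ¬ e₁ ∈ₚ C
  e₁∉C m = C∩ m (inj₁ refl)
  e₂∉C : ¬ e₂ ∈ₚ C
  e₂∉C m = C∩ m (inj₂ refl)
  swAbove′ : SwappedBeforeAbove (swapAt c s) b e₁ e₂
  swAbove′ p e₂<p e₂≺p p≺e₂ =
    trans (sym (labelLess-skip C (swappedPairs (swapAt c s) b) (p , e₂) (e₂ , e₁)
                  (≐ᵇ-false₂ C p e₂ e₂∉C) (≐ᵇ-false₁ C e₂ e₁ e₂∉C)))
          (swAbove p e₂<p (precedes-swapAt⁻ c s (≐ᵇ-false₁ C e₂ p e₂∉C) e₂≺p) p≺e₂)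
  swBelow′ : SwappedBeforeBelow (swapAt c s) b e₁ e₂
  swBelow′ q q<e₁ q≺e₁ e₁≺q =
    trans (sym (labelLess-skip C (swappedPairs (swapAt c s) b) (e₂ , e₁) (e₁ , q)
                  (≐ᵇ-false₂ C e₂ e₁ e₁∉C) (≐ᵇ-false₁ C e₁ q e₁∉C)))
          (swBelow q q<e₁ (precedes-swapAt⁻ c s (≐ᵇ-false₂ C q e₁ e₁∉C) q≺e₁) e₁≺q)
  extend : (∃₂ λ cs d → b ≡ cs ++ i ∷ d × All (FarApart i) cs) →
           ∃₂ λ cs d → c ∷ b ≡ cs ++ i ∷ d × All (FarApart i) cs
  extend (cs , d , refl , fars) = c ∷ cs , d , refl , far ∷ fars

firstSwap-reversed : ∀ {u i a} → Unique u → ReducedFrom u (i ∷ a) →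
  Precedes (entry (suc i) u) (entry i u) (applyWord u (i ∷ a))
firstSwap-reversed {u} {i} uq ((r , asc) ∷ ra) =
  inversion-persists ra (Unique-swapAt i u uq) asc (swapAt-precedes i u r)

firstSwap-beforeAbove : ∀ {u i a b} → Unique u → ReducedFrom u (i ∷ a) → applyWord u (i ∷ a) ≡ applyWord u b →
  LabelsAgree u (i ∷ a) b → SwappedBeforeAbove u b (entry i u) (entry (suc i) u)
firstSwap-beforeAbove {u} {i} {a} {b} uq ra@((r , e₁<e₂) ∷ ra′) eq agree p e₂<p e₂≺p p≺e₂ = begin
  labelLess (swappedPairs u b) (p , e₂) (e₂ , e₁)
    ≡⟨ agree e₁ e₂ p e₁<e₂ e₂<p (pairAt-precedes i u r) e₂≺p p≺e₂ᵃ (firstSwap-reversed uq ra) ⟨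
  labelLess (swappedPairs u (i ∷ a)) (p , e₂) (e₂ , e₁)
    ≡⟨ labelLess-headʳ A (swappedPairs u′ a) (p , e₂) (e₂ , e₁) (≐ᵇ-false₁ A p e₂ p∉A) (≐ᵇ-flip e₁ e₂)
         (occurs-if-reordered ra′ (Unique-swapAt i u uq) (precedes-swapAt⁺ i u (≐ᵇ-false₂ A e₂ p p∉A) e₂≺p) p≺e₂ᵃ) ⟩
  false ∎
  where
  open ≡-Reasoning
  e₁ = entry i u
  e₂ = entry (suc i) u
  A = pairAt i u
  u′ = swapAt i u
  p∉A : ¬ p ∈ₚ A
  p∉A = [ ≢-sym (<⇒≢ (<-trans e₁<e₂ e₂<p)) , ≢-sym (<⇒≢ e₂<p) ]′
  p≺e₂ᵃ : Precedes p e₂ (applyWord u′ a)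
  p≺e₂ᵃ = subst (Precedes p e₂) (sym eq) p≺e₂

firstSwap-beforeBelow : ∀ {u i a b} → Unique u → ReducedFrom u (i ∷ a) → applyWord u (i ∷ a) ≡ applyWord u b →
  LabelsAgree u (i ∷ a) b → SwappedBeforeBelow u b (entry i u) (entry (suc i) u)
firstSwap-beforeBelow {u} {i} {a} {b} uq ra@((r , e₁<e₂) ∷ ra′) eq agree q q<e₁ q≺e₁ e₁≺q = begin
  labelLess (swappedPairs u b) (e₂ , e₁) (e₁ , q)
    ≡⟨ agree q e₁ e₂ q<e₁ e₁<e₂ q≺e₁ (pairAt-precedes i u r) (firstSwap-reversed uq ra) e₁≺qᵃ ⟨
  labelLess (swappedPairs u (i ∷ a)) (e₂ , e₁) (e₁ , q)
    ≡⟨ labelLess-headˡ A (swappedPairs u′ a) (e₂ , e₁) (e₁ , q) (≐ᵇ-flip e₁ e₂) (≐ᵇ-false₂ A e₁ q q∉A)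
         (occurs-if-reordered ra′ (Unique-swapAt i u uq) (precedes-swapAt⁺ i u (≐ᵇ-false₁ A q e₁ q∉A) q≺e₁) e₁≺qᵃ) ⟩
  true ∎
  where
  open ≡-Reasoning
  e₁ = entry i u
  e₂ = entry (suc i) u
  A = pairAt i u
  u′ = swapAt i u
  q∉A : ¬ q ∈ₚ A
  q∉A = [ <⇒≢ q<e₁ , <⇒≢ (<-trans q<e₁ e₁<e₂) ]′
  e₁≺qᵃ : Precedes e₁ q (applyWord u′ a)
  e₁≺qᵃ = subst (Precedes e₁ q) (sym eq) e₁≺q

labelsAgree⇒SameCommClass : ∀ a b u → Unique u → ReducedFrom u a → ReducedFrom u b →
  applyWord u a ≡ applyWord u b → LabelsAgree u a b → SameCommClass a b
labelsAgree⇒SameCommClass []      []      u _  _  _  _  _ = ε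
labelsAgree⇒SameCommClass []      (c ∷ b) u _  ra rb eq _ = ⊥-elim (0≢1+n (ReducedFrom-length≡ ra rb eq))
labelsAgree⇒SameCommClass (i ∷ a) b       u uq ra@((r , asc) ∷ ra′) rb eq agree
  with commutingPrefix b uq rb r refl asc (subst (Precedes _ _) eq (firstSwap-reversed uq ra))
         (firstSwap-beforeAbove {b = b} uq ra eq agree) (firstSwap-beforeBelow {b = b} uq ra eq agree)
... | cs , d , refl , fars =
  ∷-SameCommClass i (labelsAgree⇒SameCommClass a (cs ++ d) (swapAt i u) (Unique-swapAt i u uq) ra′ rcd eq′ agree′)
    ◅◅ moved
  where
  moved : SameCommClass (i ∷ cs ++ d) (cs ++ i ∷ d)
  moved = commute-past i cs d fars
  rcd : ReducedFrom (swapAt i u) (cs ++ d)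
  rcd with ReducedFrom-resp-SameCommClass uq (SameCommClass-sym moved) rb
  ... | _ ∷ rcd = rcd
  eq′ : applyWord (swapAt i u) a ≡ applyWord (swapAt i u) (cs ++ d)
  eq′ = trans eq (sym (SameCommClass⇒applyWord≡ moved u))
  agree′ : LabelsAgree (swapAt i u) a (cs ++ d)
  agree′ = LabelsAgree-tail {a = a} {b = cs ++ d} uq (r , asc)
             (LabelsAgree-resp-SameCommClass {a = i ∷ a} uq (ReducedFrom⇒Letters rb) (SameCommClass-sym moved) agree)

-- Runs from the identity word

identityWord-sorted : ∀ n → AllPairs _<_ (identityWord n)
identityWord-sorted n = AllPairs.map⁺ (AllPairs.applyUpTo⁺₁ id n (λ i<j _ → s≤s i<j))

Unique-identityWord : ∀ n → Unique (identityWord n)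
Unique-identityWord n = AllPairs-map <⇒≢ (identityWord-sorted n)

countLess-below : ∀ x ys → All (x <_) ys → countLess x ys ≡ 0
countLess-below x []       []          = refl
countLess-below x (y ∷ ys) (x<y ∷ x<ys) rewrite <ᵇ-false {y} {x} (<⇒≤ x<y) = countLess-below x ys x<ys

inversions-sorted : ∀ xs → AllPairs _<_ xs → inversions xs ≡ 0
inversions-sorted []       []            = refl
inversions-sorted (x ∷ xs) (x<xs ∷ sorted) rewrite countLess-below x xs x<xs = inversions-sorted xs sorted

length-identityWord : ∀ n → length (identityWord n) ≡ n
length-identityWord n = trans (length-map suc (upTo n)) (length-upTo n)

Reduced⇒ReducedFrom : ∀ {n w a} → Reduced n w a → ReducedFrom (identityWord n) a
Reduced⇒ReducedFrom {n} {w} {a} (letters , reaches-w , length≡) =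
  ReducedFrom-from-inversions u a (Unique-identityWord n) (subst (λ N → Letters N a) (sym (length-identityWord n)) letters) (begin
    inversions (applyWord u a)  ≡⟨ cong inversions reaches-w ⟩
    inversions w                ≡⟨ length≡ ⟨
    length a                    ≡⟨ +-identityʳ (length a) ⟨
    length a + 0                ≡⟨ cong (length a +_) (inversions-sorted u (identityWord-sorted n)) ⟨
    length a + inversions u     ∎)
  where
  open ≡-Reasoning
  u = identityWord n

indicator : Bool → ℕ
indicator t = if t then 1 else 0

indicator-injective : ∀ {t t′} → indicator t ≡ indicator t′ → t ≡ t′
indicator-injective {true}  {true}  _ = refl
indicator-injective {false} {false} _ = refl

Γ≡⇔labelLess≡ : ∀ n a b x y z → (Γ n a x y z ≡ Γ n b x y z) ⇔
  (labelLess (swappedPairs (identityWord n) a) (z , y) (y , x) ≡ labelLess (swappedPairs (identityWord n) b) (z , y) (y , x))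
Γ≡⇔labelLess≡ n a b x y z = mk⇔
  (λ Γ≡ → indicator-injective (trans (sym (Γ-labelLess a)) (trans Γ≡ (Γ-labelLess b))))
  (λ ℓ≡ → trans (Γ-labelLess a) (trans (cong indicator ℓ≡) (sym (Γ-labelLess b))))
  where
  Γ-labelLess : ∀ c → Γ n c x y z ≡ indicator (labelLess (swappedPairs (identityWord n) c) (z , y) (y , x))
  Γ-labelLess c = cong indicator (labelFrom-<ᵇ 0 (identityWord n) c z y y x)

mainTheorem5 : (n : ℕ) → 2 ≤ n → (w : List ℕ) → IsPerm n w →
    (a b : List ℕ) → Reduced n w a → Reduced n w b →
    (SameCommClass a b ⇔
    (∀ x y z → InT w x y z → Γ n a x y z ≡ Γ n b x y z))
mainTheorem5 n _ w _ a b ra@(letters , reaches-w , _) rb@(_ , reaches-w′ , _) = mk⇔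
  (λ a~b x y z _ → Equivalence.from (Γ≡⇔labelLess≡ n a b x y z)
     (labelLess-resp-SameCommClass u uq (ReducedFrom⇒Letters (Reduced⇒ReducedFrom ra)) a~b x y z))
  (λ Γ≡ → labelsAgree⇒SameCommClass a b u uq (Reduced⇒ReducedFrom ra) (Reduced⇒ReducedFrom rb)
     (trans reaches-w (sym reaches-w′))
     (λ x y z x<y y<z _ _ z≺y y≺x → Equivalence.to (Γ≡⇔labelLess≡ n a b x y z)
        (Γ≡ x y z (x<y , y<z , inW z≺y , inW y≺x))))
  where
  u = identityWord n
  uq = Unique-identityWord n
  inW : ∀ {p q} → Precedes p q (applyWord u a) → Before p q w
  inW = precedes⇒Before ∘ subst (Precedes _ _) reaches-w
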